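{- For every positive integer $k$, $\operatorname{mp}(Q_{2k})\geqslant k$.
   Context: $Q_m$ is the $m$-dimensional hypercube: vertex set $\{0,1\}^m$, two vertices adjacent iff they differ in exactly one coordinate. For a vertex $v$ and integer $k\geqslant 0$, $N_k[v]$ is the set of vertices at graph distance at most $k$ from $v$. A set $M$ of vertices is a multipacking if $|N_k[v]\cap M|\leqslant k$ for every vertex $v$ and every integer $k\geqslant 1$; $\operatorname{mp}(G)$ is the maximum size of a multipacking in $G$. -}

module Defs where

open import Data.Bool using (Bool; true; false)
open import Data.Nat using (ℕ; zero; suc; _+_; _≤_; _≤?_)
open import Data.Vec using (Vec; []; _∷_)
open import Data.List using (List; length; filter)
open import Data.List.Relation.Unary.Unique.Propositional using (Unique)
open import Data.Product using (Σ; _×_)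

Vertex : ℕ → Set
Vertex m = Vec Bool m

-- Number of coordinates in which two vertices differ (Hamming distance).
-- In Q_m (adjacent iff differing in exactly one coordinate) this is exactly
-- the graph distance.
dist : {m : ℕ} → Vertex m → Vertex m → ℕ
dist [] [] = 0
dist (true ∷ u) (true ∷ v) = dist u v
dist (false ∷ u) (false ∷ v) = dist u v
dist (true ∷ u) (false ∷ v) = suc (dist u v)
dist (false ∷ u) (true ∷ v) = suc (dist u v)

-- |N_k[v] ∩ M| for a finite set M given as a duplicate-free list.
countBall : {m : ℕ} → Vertex m → ℕ → List (Vertex m) → ℕ
countBall v k M = length (filter (λ u → dist v u ≤? k) M)

IsMultipacking : (m : ℕ) → List (Vertex m) → Set
IsMultipacking m M =
  Unique M × ((v : Vertex m) (k : ℕ) → 1 ≤ k → countBall v k M ≤ k)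

-- mp(Q_m) ≥ n : there is a multipacking of Q_m of size at least n
-- (mp is the maximum size of a multipacking; the vertex set is finite).
MpAtLeast : ℕ → ℕ → Set
MpAtLeast m n = Σ (List (Vertex m)) (λ M → IsMultipacking m M × (n ≤ length M))

{-# OPTIONS --safe #-}
module Submission where

-- Call x₀, x₁, …, x_{n−1} spread if d(xᵢ, xⱼ) > 2(j − i) whenever i < j. Two points of a ball
-- of radius r are at distance at most 2r, so the indices of the points of a spread sequence
-- lying in such a ball differ by less than r: there are at most r of them, and a spread
-- sequence is a multipacking.
--
-- Write Q_{2k} = Q_k × Q_k, let eₚ be the p-th unit vector and 1ˢ the indicator of the first
-- s coordinates of Q_k. For 1 ≤ s ≤ k take (e_{s−1}, 1ˢ) if s is odd and (1ˢ, e_{s−1}) if s is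
-- even. Two of these points at parameters s < t are at distance 2 + (t − s) if s ≡ t mod 2 and
-- at distance s + t otherwise, so listing them by decreasing odd s followed by increasing even
-- s gives a spread sequence of length k.

open import Defs
open import Data.Nat using (ℕ; zero; suc; _+_; _*_; _≤_; _<_; z≤n; s≤s; z<s; _≤?_; ⌊_/2⌋; ⌈_/2⌉)
open import Data.Nat.Properties
open import Data.Nat.Tactic.RingSolver using (solve-∀)
open import Algebra.Properties.CommutativeSemigroup +-commutativeSemigroup
  using (interchange; x∙yz≈y∙xz; xy∙z≈xz∙y)
open import Data.Bool using (true; false)
open import Data.Vec using ([]; _∷_; _++_; [_])
open import Data.List using (length; filter; applyDownFrom)
open import Data.List.Properties using (length-applyDownFrom)
open import Data.List.Relation.Unary.Unique.Propositional.Properties using (applyDownFrom⁺₁)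
open import Data.Product using (_,_)
open import Data.Empty using (⊥-elim)
open import Relation.Nullary using (yes; no)
open import Relation.Unary using (Pred; Decidable)
open import Relation.Binary.Definitions using (tri<; tri≈; tri>)
open import Relation.Binary.PropositionalEquality
  using (_≡_; _≢_; refl; sym; trans; cong; cong₂; subst; subst₂; module ≡-Reasoning)

dist-self : ∀ {m} (u : Vertex m) → dist u u ≡ 0
dist-self [] = refl
dist-self (true ∷ u) = dist-self u
dist-self (false ∷ u) = dist-self u

dist-sym : ∀ {m} (u v : Vertex m) → dist u v ≡ dist v u
dist-sym [] [] = refl
dist-sym (true ∷ u) (true ∷ v) = dist-sym u v
dist-sym (false ∷ u) (false ∷ v) = dist-sym u v
dist-sym (true ∷ u) (false ∷ v) = cong suc (dist-sym u v)
dist-sym (false ∷ u) (true ∷ v) = cong suc (dist-sym u v)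

dist-++ : ∀ {m n} (u u′ : Vertex m) (w w′ : Vertex n) →
          dist (u ++ w) (u′ ++ w′) ≡ dist u u′ + dist w w′
dist-++ [] [] w w′ = refl
dist-++ (true ∷ u) (true ∷ u′) w w′ = dist-++ u u′ w w′
dist-++ (false ∷ u) (false ∷ u′) w w′ = dist-++ u u′ w w′
dist-++ (true ∷ u) (false ∷ u′) w w′ = cong suc (dist-++ u u′ w w′)
dist-++ (false ∷ u) (true ∷ u′) w w′ = cong suc (dist-++ u u′ w w′)

bit-triangle : ∀ x y z → dist [ x ] [ z ] ≤ dist [ x ] [ y ] + dist [ y ] [ z ]
bit-triangle true  _     true  = z≤n
bit-triangle false _     false = z≤n
bit-triangle true  true  false = s≤s z≤n
bit-triangle true  false false = s≤s z≤n
bit-triangle false true  true  = s≤s z≤n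
bit-triangle false false true  = s≤s z≤n

dist-triangle : ∀ {m} (u v w : Vertex m) → dist u w ≤ dist u v + dist v w
dist-triangle [] [] [] = z≤n
dist-triangle (x ∷ u) (y ∷ v) (z ∷ w) = begin
  dist (x ∷ u) (z ∷ w)
    ≡⟨ dist-++ [ x ] [ z ] u w ⟩
  dist [ x ] [ z ] + dist u w
    ≤⟨ +-mono-≤ (bit-triangle x y z) (dist-triangle u v w) ⟩
  (dist [ x ] [ y ] + dist [ y ] [ z ]) + (dist u v + dist v w)
    ≡⟨ interchange (dist [ x ] [ y ]) _ _ _ ⟩
  (dist [ x ] [ y ] + dist u v) + (dist [ y ] [ z ] + dist v w)
    ≡⟨ cong₂ _+_ (dist-++ [ x ] [ y ] u v) (dist-++ [ y ] [ z ] v w) ⟨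
  dist (x ∷ u) (y ∷ v) + dist (y ∷ v) (z ∷ w) ∎
  where open ≤-Reasoning

dist-within-ball : ∀ {m} (v u w : Vertex m) {r} →
                   dist v u ≤ r → dist v w ≤ r → dist u w ≤ r + r
dist-within-ball v u w v-u v-w =
  ≤-trans (dist-triangle u v w) (+-mono-≤ (≤-trans (≤-reflexive (dist-sym u v)) v-u) v-w)

module _ {a p} {A : Set a} {P : Pred A p} (P? : Decidable P) (f : ℕ → A) where

  filter-applyDownFrom-window : ∀ n m → (∀ {i} → i < n → P (f i) → n ≤ i + m) →
                                length (filter P? (applyDownFrom f n)) ≤ m
  filter-applyDownFrom-window zero m _ = z≤n
  filter-applyDownFrom-window (suc n) m window with P? (f n)
  filter-applyDownFrom-window (suc n) zero window | yes Pfn =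
    ⊥-elim (<-irrefl (sym (+-identityʳ n)) (window (n<1+n n) Pfn))
  filter-applyDownFrom-window (suc n) (suc m) window | yes _ =
    s≤s (filter-applyDownFrom-window n m λ i<n Pfi →
           ≤-pred (≤-trans (window (m<n⇒m<1+n i<n) Pfi) (≤-reflexive (+-suc _ m))))
  ... | no _ =
    filter-applyDownFrom-window n m λ i<n Pfi → ≤-trans (n≤1+n n) (window (m<n⇒m<1+n i<n) Pfi)

  filter-applyDownFrom-cluster : ∀ n r → 1 ≤ r →
                                 (∀ {i j} → i < j → j < n → P (f i) → P (f j) → j < i + r) →
                                 length (filter P? (applyDownFrom f n)) ≤ r
  filter-applyDownFrom-cluster zero r _ _ = z≤n
  filter-applyDownFrom-cluster (suc n) r 1≤r cluster with P? (f n)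
  filter-applyDownFrom-cluster (suc n) (suc r) _ cluster | yes Pfn =
    s≤s (filter-applyDownFrom-window n r λ i<n Pfi →
           ≤-pred (≤-trans (cluster i<n (n<1+n n) Pfi Pfn) (≤-reflexive (+-suc _ r))))
  ... | no _ =
    filter-applyDownFrom-cluster n r 1≤r λ i<j j<n → cluster i<j (m<n⇒m<1+n j<n)

Spread : ∀ {m} → (ℕ → Vertex m) → ℕ → Set
Spread x n = ∀ {i j} → i < j → j < n → 2 * j < 2 * i + dist (x i) (x j)

spread⇒multipacking : ∀ {m n} (x : ℕ → Vertex m) → Spread x n →
                      IsMultipacking m (applyDownFrom x n)
spread⇒multipacking {m} {n} x spread = applyDownFrom⁺₁ x n distinct , ball
  where
  distinct : ∀ {i j} → j < i → i < n → x i ≢ x j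
  distinct {i} {j} j<i i<n xi≡xj =
    <-asym (*-monoʳ-< 2 j<i) (subst (2 * i <_) no-gap (spread j<i i<n))
    where
    no-gap : 2 * j + dist (x j) (x i) ≡ 2 * j
    no-gap = begin
      2 * j + dist (x j) (x i)  ≡⟨ cong (λ u → 2 * j + dist (x j) u) xi≡xj ⟩
      2 * j + dist (x j) (x j)  ≡⟨ cong (2 * j +_) (dist-self (x j)) ⟩
      2 * j + 0                 ≡⟨ +-identityʳ (2 * j) ⟩
      2 * j                     ∎
      where open ≡-Reasoning
  ball : (v : Vertex m) (r : ℕ) → 1 ≤ r → countBall v r (applyDownFrom x n) ≤ r
  ball v r 1≤r = filter-applyDownFrom-cluster (λ u → dist v u ≤? r) x n r 1≤r
    λ {i} {j} i<j j<n vi vj → *-cancelˡ-< 2 j (i + r) (begin-strict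
      2 * j                     <⟨ spread i<j j<n ⟩
      2 * i + dist (x i) (x j)  ≤⟨ +-monoʳ-≤ (2 * i) (dist-within-ball v (x i) (x j) vi vj) ⟩
      2 * i + (r + r)           ≡⟨ cong (λ s → 2 * i + (r + s)) (+-identityʳ r) ⟨
      2 * i + 2 * r             ≡⟨ *-distribˡ-+ 2 i r ⟨
      2 * (i + r)               ∎)
    where open ≤-Reasoning

spread⇒mpAtLeast : ∀ {m n} (x : ℕ → Vertex m) → Spread x n → MpAtLeast m n
spread⇒mpAtLeast {n = n} x spread =
  applyDownFrom x n , spread⇒multipacking x spread , ≤-reflexive (sym (length-applyDownFrom x n))

data Side (n i : ℕ) : Set where
  front : ∀ a → i + suc a ≡ n → Side n i
  back  : ∀ b → n + b ≡ i → Side n i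

side : ∀ n i → Side n i
side zero i = back i refl
side (suc n) zero = front n refl
side (suc n) (suc i) with side n i
... | front a eq = front a (cong suc eq)
... | back b eq = back b (cong suc eq)

-- The sequence f (n − 1), …, f 1, f 0, g 0, g 1, g 2, …
backToBack : ∀ {a} {A : Set a} → ℕ → (ℕ → A) → (ℕ → A) → ℕ → A
backToBack n f g i with side n i
... | front a _ = f a
... | back b _ = g b

front⇒< : ∀ {n i a} → i + suc a ≡ n → a < n
front⇒< {i = i} {a} eq = subst (a <_) eq (m≤n+m (suc a) i)

front⇒index< : ∀ {n i a} → i + suc a ≡ n → i < n
front⇒index< {i = i} eq = subst (i <_) eq (m<m+n i z<s)

back⇒< : ∀ {n i b} m → n + b ≡ i → i < n + m → b < m
back⇒< {n} m refl i<n+m = +-cancelˡ-< n _ m i<n+m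

shift-gap : ∀ i j p q {d} → i + p ≡ j + q → 2 * p < 2 * q + d → 2 * j < 2 * i + d
shift-gap i j p q {d} eq lt = +-cancelˡ-< (2 * q) (2 * j) (2 * i + d) (begin-strict
  2 * q + 2 * j        ≡⟨ *-distribˡ-+ 2 q j ⟨
  2 * (q + j)          ≡⟨ cong (2 *_) (trans (+-comm q j) (sym eq)) ⟩
  2 * (i + p)          ≡⟨ *-distribˡ-+ 2 i p ⟩
  2 * i + 2 * p        <⟨ +-monoʳ-< (2 * i) lt ⟩
  2 * i + (2 * q + d)  ≡⟨ x∙yz≈y∙xz (2 * i) (2 * q) d ⟩
  2 * q + (2 * i + d)  ∎)
  where open ≤-Reasoning

backToBack-spread : ∀ {m nf ng} {f g : ℕ → Vertex m} → Spread f nf → Spread g ng →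
                    (∀ {a b} → a < nf → b < ng → 2 * suc (a + b) < dist (f a) (g b)) →
                    Spread (backToBack nf f g) (nf + ng)
backToBack-spread {nf = nf} {ng} {f} {g} spread-f spread-g cross {i} {j} i<j j<n
  with side nf i | side nf j
... | front a eqᵢ | front a′ eqⱼ =
  shift-gap i j a a′ i+a≡j+a′
    (subst (2 * a <_) (cong (2 * a′ +_) (dist-sym (f a′) (f a))) (spread-f a′<a (front⇒< eqᵢ)))
  where
  i+a≡j+a′ : i + a ≡ j + a′
  i+a≡j+a′ = suc-injective (trans (sym (+-suc i a)) (trans (trans eqᵢ (sym eqⱼ)) (+-suc j a′)))
  a′<a : a′ < a
  a′<a = +-cancelˡ-< j a′ a (subst (_< j + a) i+a≡j+a′ (+-monoˡ-< a i<j))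
... | front a eqᵢ | back b eqⱼ =
  shift-gap i j (suc (a + b)) 0 i+[1+a+b]≡j+0 (cross (front⇒< eqᵢ) (back⇒< ng eqⱼ j<n))
  where
  i+[1+a+b]≡j+0 : i + suc (a + b) ≡ j + 0
  i+[1+a+b]≡j+0 = begin
    i + suc (a + b)  ≡⟨ +-assoc i (suc a) b ⟨
    i + suc a + b    ≡⟨ cong (_+ b) eqᵢ ⟩
    nf + b           ≡⟨ eqⱼ ⟩
    j                ≡⟨ +-identityʳ j ⟨
    j + 0            ∎
    where open ≡-Reasoning
... | back b eqᵢ | front a′ eqⱼ =
  ⊥-elim (<-irrefl refl (<-trans (≤-<-trans nf≤i i<j) (front⇒index< eqⱼ)))
  where
  nf≤i : nf ≤ i
  nf≤i = subst (nf ≤_) eqᵢ (m≤m+n nf b)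
... | back b eqᵢ | back b′ eqⱼ =
  shift-gap i j b′ b i+b′≡j+b (spread-g b<b′ (back⇒< ng eqⱼ j<n))
  where
  b<b′ : b < b′
  b<b′ = +-cancelˡ-< nf b b′ (subst₂ _<_ (sym eqᵢ) (sym eqⱼ) i<j)
  i+b′≡j+b : i + b′ ≡ j + b
  i+b′≡j+b = begin
    i + b′       ≡⟨ cong (_+ b′) eqᵢ ⟨
    nf + b + b′  ≡⟨ xy∙z≈xz∙y nf b b′ ⟩
    nf + b′ + b  ≡⟨ cong (_+ b) eqⱼ ⟩
    j + b        ∎
    where open ≡-Reasoning

initial : (n t : ℕ) → Vertex n
initial zero _ = []
initial (suc n) zero = false ∷ initial n zero
initial (suc n) (suc t) = true ∷ initial n t

unit : (n p : ℕ) → Vertex n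
unit zero _ = []
unit (suc n) zero = true ∷ initial n zero
unit (suc n) (suc p) = false ∷ unit n p

dist-initial : ∀ {n s t} → s ≤ t → t ≤ n → s + dist (initial n s) (initial n t) ≡ t
dist-initial {zero} z≤n z≤n = refl
dist-initial {suc n} {t = zero} z≤n _ = dist-self (initial n zero)
dist-initial {suc n} {t = suc t} z≤n (s≤s t≤n) = cong suc (dist-initial z≤n t≤n)
dist-initial {suc n} (s≤s s≤t) (s≤s t≤n) = cong suc (dist-initial s≤t t≤n)

dist-unit-initial-< : ∀ {n p t} → p < t → t ≤ n → suc (dist (unit n p) (initial n t)) ≡ t
dist-unit-initial-< {suc n} {zero} (s≤s z≤n) (s≤s t≤n) = cong suc (dist-initial z≤n t≤n)
dist-unit-initial-< {suc n} {suc p} (s≤s p<t) (s≤s t≤n) = cong suc (dist-unit-initial-< p<t t≤n)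

dist-unit-initial-≥ : ∀ {n p t} → t ≤ p → p < n → dist (unit n p) (initial n t) ≡ suc t
dist-unit-initial-≥ {suc n} {zero} z≤n _ = cong suc (dist-self (initial n zero))
dist-unit-initial-≥ {suc n} {suc p} z≤n (s≤s p<n) = dist-unit-initial-≥ z≤n p<n
dist-unit-initial-≥ {suc n} {suc p} (s≤s t≤p) (s≤s p<n) =
  cong suc (dist-unit-initial-≥ t≤p p<n)

dist-unit-unit : ∀ {n p q} → p < q → q < n → dist (unit n p) (unit n q) ≡ 2
dist-unit-unit {suc n} {zero} {suc q} _ (s≤s q<n) =
  cong suc (trans (dist-sym (initial n zero) (unit n q)) (dist-unit-initial-≥ z≤n q<n))
dist-unit-unit {suc n} {suc p} {suc q} (s≤s p<q) (s≤s q<n) = dist-unit-unit p<q q<n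

dist-unit+dist-initial :
  ∀ {n p q} → p < q → q < n →
  p + (dist (unit n p) (unit n q) + dist (initial n (suc p)) (initial n (suc q))) ≡ 2 + q
dist-unit+dist-initial {n} {p} {q} p<q q<n = begin
  p + (dist (unit n p) (unit n q) + dᵢ)  ≡⟨ cong (λ d → p + (d + dᵢ)) (dist-unit-unit p<q q<n) ⟩
  p + (2 + dᵢ)                           ≡⟨ x∙yz≈y∙xz p 2 dᵢ ⟩
  2 + (p + dᵢ)                           ≡⟨ cong (2 +_) p+dᵢ≡q ⟩
  2 + q                                  ∎
  where
  open ≡-Reasoning
  dᵢ : ℕ
  dᵢ = dist (initial n (suc p)) (initial n (suc q))
  p+dᵢ≡q : p + dᵢ ≡ q
  p+dᵢ≡q = suc-injective (dist-initial (s≤s (<⇒≤ p<q)) q<n)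

dist-unit-initial+dist-initial-unit-< :
  ∀ {n p q} → p < q → q < n →
  dist (unit n p) (initial n (suc q)) + dist (initial n (suc p)) (unit n q) ≡ 2 + (p + q)
dist-unit-initial+dist-initial-unit-< {n} {p} {q} p<q q<n = begin
  dist (unit n p) (initial n (suc q)) + dist (initial n (suc p)) (unit n q)
    ≡⟨ cong₂ _+_ (suc-injective (dist-unit-initial-< (s≤s (<⇒≤ p<q)) q<n))
                 (trans (dist-sym (initial n (suc p)) (unit n q)) (dist-unit-initial-≥ p<q q<n)) ⟩
  q + suc (suc p)
    ≡⟨ y+[2+x]≡2+[x+y] p q ⟩
  2 + (p + q) ∎
  where
  open ≡-Reasoning
  y+[2+x]≡2+[x+y] : ∀ x y → y + suc (suc x) ≡ 2 + (x + y)
  y+[2+x]≡2+[x+y] = solve-∀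

dist-unit-initial+dist-initial-unit :
  ∀ {n p q} → p ≢ q → p < n → q < n →
  dist (unit n p) (initial n (suc q)) + dist (initial n (suc p)) (unit n q) ≡ 2 + (p + q)
dist-unit-initial+dist-initial-unit {n} {p} {q} p≢q p<n q<n with <-cmp p q
... | tri< p<q _ _ = dist-unit-initial+dist-initial-unit-< p<q q<n
... | tri≈ _ p≡q _ = ⊥-elim (p≢q p≡q)
... | tri> _ _ q<p = begin
  dist (unit n p) (initial n (suc q)) + dist (initial n (suc p)) (unit n q)
    ≡⟨ +-comm (dist (unit n p) (initial n (suc q))) _ ⟩
  dist (initial n (suc p)) (unit n q) + dist (unit n p) (initial n (suc q))
    ≡⟨ cong₂ _+_ (dist-sym (initial n (suc p)) (unit n q))
                 (dist-sym (unit n p) (initial n (suc q))) ⟩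
  dist (unit n q) (initial n (suc p)) + dist (initial n (suc q)) (unit n p)
    ≡⟨ dist-unit-initial+dist-initial-unit-< q<p p<n ⟩
  2 + (q + p)
    ≡⟨ cong (2 +_) (+-comm q p) ⟩
  2 + (p + q) ∎
  where open ≡-Reasoning

join : ∀ {k} → Vertex k → Vertex k → Vertex (2 * k)
join u w = u ++ w ++ []

dist-join : ∀ {k} (u u′ w w′ : Vertex k) →
            dist (join u w) (join u′ w′) ≡ dist u u′ + dist w w′
dist-join u u′ w w′ =
  trans (dist-++ u u′ (w ++ []) (w′ ++ []))
        (cong (dist u u′ +_) (trans (dist-++ w w′ [] []) (+-identityʳ _)))

leftPoint : (k a : ℕ) → Vertex (2 * k)
leftPoint k a = join (unit k (2 * a)) (initial k (suc (2 * a)))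

rightPoint : (k b : ℕ) → Vertex (2 * k)
rightPoint k b = join (initial k (suc (suc (2 * b)))) (unit k (suc (2 * b)))

m<⌊n/2⌋⇒1+2m<n : ∀ {m n} → m < ⌊ n /2⌋ → suc (2 * m) < n
m<⌊n/2⌋⇒1+2m<n {zero} {suc (suc n)} _ = s≤s (s≤s z≤n)
m<⌊n/2⌋⇒1+2m<n {suc m} {suc (suc n)} (s≤s m<⌊n/2⌋) rewrite *-suc 2 m =
  s≤s (s≤s (m<⌊n/2⌋⇒1+2m<n m<⌊n/2⌋))

m<⌈n/2⌉⇒2m<n : ∀ {m n} → m < ⌈ n /2⌉ → 2 * m < n
m<⌈n/2⌉⇒2m<n m<⌈n/2⌉ = ≤-pred (m<⌊n/2⌋⇒1+2m<n m<⌈n/2⌉)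

leftPoint-spread : ∀ k → Spread (leftPoint k) ⌈ k /2⌉
leftPoint-spread k {a} {a′} a<a′ a′<⌈k/2⌉ =
  subst (2 * a′ <_) (sym 2a+d≡2+2a′) (m<n+m (2 * a′) {2} z<s)
  where
  2a+d≡2+2a′ : 2 * a + dist (leftPoint k a) (leftPoint k a′) ≡ 2 + 2 * a′
  2a+d≡2+2a′ = trans (cong (2 * a +_) (dist-join (unit k _) (unit k _) (initial k _) (initial k _)))
                     (dist-unit+dist-initial (*-monoʳ-< 2 a<a′) (m<⌈n/2⌉⇒2m<n a′<⌈k/2⌉))

rightPoint-spread : ∀ k → Spread (rightPoint k) ⌊ k /2⌋
rightPoint-spread k {b} {b′} b<b′ b′<⌊k/2⌋ =
  subst (2 * b′ <_) (sym 2b+d≡2+2b′) (m<n+m (2 * b′) {2} z<s)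
  where
  dᵤ dᵢ : ℕ
  dᵤ = dist (unit k (suc (2 * b))) (unit k (suc (2 * b′)))
  dᵢ = dist (initial k (suc (suc (2 * b)))) (initial k (suc (suc (2 * b′))))
  2b+d≡2+2b′ : 2 * b + dist (rightPoint k b) (rightPoint k b′) ≡ 2 + 2 * b′
  2b+d≡2+2b′ = suc-injective (begin
    suc (2 * b) + dist (rightPoint k b) (rightPoint k b′)
      ≡⟨ cong (suc (2 * b) +_) (dist-join (initial k _) (initial k _) (unit k _) (unit k _)) ⟩
    suc (2 * b) + (dᵢ + dᵤ)
      ≡⟨ cong (suc (2 * b) +_) (+-comm dᵢ dᵤ) ⟩
    suc (2 * b) + (dᵤ + dᵢ)
      ≡⟨ dist-unit+dist-initial (s≤s (*-monoʳ-< 2 b<b′)) (m<⌊n/2⌋⇒1+2m<n b′<⌊k/2⌋) ⟩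
    suc (2 + 2 * b′) ∎)
    where open ≡-Reasoning

dist-leftPoint-rightPoint : ∀ {k a b} → 2 * a < k → suc (2 * b) < k →
                            dist (leftPoint k a) (rightPoint k b) ≡ suc (2 * suc (a + b))
dist-leftPoint-rightPoint {k} {a} {b} 2a<k 1+2b<k = begin
  dist (leftPoint k a) (rightPoint k b)
    ≡⟨ dist-join (unit k _) (initial k _) (initial k _) (unit k _) ⟩
  dist (unit k (2 * a)) (initial k (suc (suc (2 * b))))
    + dist (initial k (suc (2 * a))) (unit k (suc (2 * b)))
    ≡⟨ dist-unit-initial+dist-initial-unit (even≢odd a b) 2a<k 1+2b<k ⟩
  2 + (2 * a + suc (2 * b))
    ≡⟨ 2+[2a+[1+2b]]≡1+2[1+a+b] a b ⟩
  suc (2 * suc (a + b)) ∎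
  where
  open ≡-Reasoning
  2+[2a+[1+2b]]≡1+2[1+a+b] : ∀ a b → 2 + (2 * a + suc (2 * b)) ≡ suc (2 * suc (a + b))
  2+[2a+[1+2b]]≡1+2[1+a+b] = solve-∀

cubePoints : (k : ℕ) → ℕ → Vertex (2 * k)
cubePoints k = backToBack ⌈ k /2⌉ (leftPoint k) (rightPoint k)

cubePoints-spread : ∀ k → Spread (cubePoints k) (⌈ k /2⌉ + ⌊ k /2⌋)
cubePoints-spread k = backToBack-spread (leftPoint-spread k) (rightPoint-spread k)
  λ {a} {b} a<⌈k/2⌉ b<⌊k/2⌋ → ≤-reflexive (sym (dist-leftPoint-rightPoint {k} {a} {b}
    (m<⌈n/2⌉⇒2m<n a<⌈k/2⌉) (m<⌊n/2⌋⇒1+2m<n b<⌊k/2⌋)))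

lemma2 : (k : ℕ) → 1 ≤ k → MpAtLeast (2 * k) k
lemma2 k _ =
  subst (MpAtLeast (2 * k)) ⌈k/2⌉+⌊k/2⌋≡k (spread⇒mpAtLeast (cubePoints k) (cubePoints-spread k))
  where
  ⌈k/2⌉+⌊k/2⌋≡k : ⌈ k /2⌉ + ⌊ k /2⌋ ≡ k
  ⌈k/2⌉+⌊k/2⌋≡k = trans (+-comm ⌈ k /2⌉ ⌊ k /2⌋) (⌊n/2⌋+⌈n/2⌉≡n k)
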